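{- Let $n=p^{\alpha}$ with $p$ prime and $\alpha\ge4$. If $\Upsilon_n\cong\Upsilon_m$ for some composite integer $m$, then $n$ and $m$ are similar (i.e. $m=q^{\alpha}$ for some prime $q$).
   Context: For an integer $n>1$, a proper divisor of $n$ is an integer $d$ with $1<d<n$ and $d\mid n$. The proper divisor graph $\Upsilon_n$ is the simple graph whose vertices are the proper divisors of $n$, two distinct vertices $u,v$ being adjacent iff $n\mid uv$. Two positive integers with prime power factorizations $p_1^{\alpha_1}\cdots p_k^{\alpha_k}$ and $q_1^{\beta_1}\cdots q_l^{\beta_l}$ (exponents listed in non-increasing order) are similar if $k=l$ and $\alpha_i=\beta_i$ for all $i$. -}

module Defs where

open import Data.Nat using (ℕ; _<_; _*_)
open import Data.Nat.Divisibility using (_∣_)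
open import Data.Product using (Σ; _×_; proj₁)
open import Relation.Binary.PropositionalEquality using (_≡_)
open import Relation.Nullary using (¬_)
open import Function.Bundles using (_⤖_; Bijection)

ProperDivisor : ℕ → Set
ProperDivisor n = Σ ℕ (λ d → (1 < d) × (d < n) × (d ∣ n))

-- Adjacency in the proper divisor graph Υ_n (a simple graph, so
-- adjacency requires distinct vertices): u ~ v iff u ≠ v and n ∣ u v.
Adj : (n : ℕ) → ProperDivisor n → ProperDivisor n → Set
Adj n u v = (¬ (proj₁ u ≡ proj₁ v)) × (n ∣ (proj₁ u * proj₁ v))

_≅Υ_ : ℕ → ℕ → Set
n ≅Υ m = Σ (ProperDivisor n ⤖ ProperDivisor m) (λ f →
           ∀ u v → (Adj n u v → Adj m (Bijection.to f u) (Bijection.to f v))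
                 × (Adj m (Bijection.to f u) (Bijection.to f v) → Adj n u v))

{-# OPTIONS --safe #-}
-- The vertex p^(α-1) of Υ_{p^α} is adjacent to every other vertex, so its image D under an
-- isomorphism is adjacent to every other vertex of Υ_m, i.e. the cofactor e = m/D divides every
-- proper divisor of m other than D. If D were prime, every other vertex would be a multiple of e
-- properly dividing e D, hence equal to e; but p and p² give two of them. So D is not prime, every prime
-- factor of m is a proper divisor different from D and hence equals e, and m = e^β. Finally
-- Υ_{q^(b+1)} has exactly b vertices, so the isomorphism forces β = α.
module Submission where

open import Defs
open import Data.Nat
  using (ℕ; zero; suc; _*_; _^_; _≤_; _<_; NonZero; z≤n; s≤s; z<s; s<s; nonTrivial⇒n>1; >-nonZero)
open import Data.Nat.Properties
open import Data.Nat.Divisibility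
open import Data.Nat.Primality
  using ( Prime; Composite; prime?; euclidsLemma; prime⇒irreducible; prime⇒nonTrivial
        ; composite⇒nonZero; composite⇒nonTrivial; composite⇒¬prime)
open import Data.Nat.Primality.Factorisation using (factorise; factors; module PrimeFactorisation)
open import Data.Nat.ListAction using (product)
open import Data.Nat.ListAction.Properties using (∈⇒∣product)
open import Data.List using ([]; _∷_; length)
open import Data.List.Membership.Propositional using (_∈_)
open import Data.List.Relation.Unary.Any using (here; there)
import Data.List.Relation.Unary.All as All
open import Data.Fin using (Fin; toℕ; fromℕ<)
open import Data.Fin.Properties using (toℕ<n; toℕ-injective; toℕ-fromℕ<; cantor-schröder-bernstein)
open import Data.Product using (Σ; ∃; _×_; proj₁; proj₂; _,_)
open import Data.Sum using (inj₁; inj₂)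
open import Relation.Nullary using (¬_; Dec; yes; no; contradiction)
open import Relation.Binary.PropositionalEquality using (_≡_; _≢_; refl; sym; trans; cong; cong₂; subst)
open import Relation.Binary.Definitions using (tri<; tri≈; tri>)
open import Function using (_∘_)
open import Function.Bundles using (_⤖_; Bijection; mk⤖)
open import Function.Construct.Composition using (_⤖-∘_)
open import Function.Construct.Symmetry using (⤖-sym)
open import Function.Consequences.Propositional using (strictlySurjective⇒surjective)

open Bijection using (to)

prime⇒1< : ∀ {p} → Prime p → 1 < p
prime⇒1< {p} pr = nonTrivial⇒n>1 p {{prime⇒nonTrivial pr}}

∣-irrelevant : ∀ {m n} .{{_ : NonZero m}} (x y : m ∣ n) → x ≡ y
∣-irrelevant {m} (divides q₁ eq₁) (divides q₂ eq₂)
  with *-cancelʳ-≡ q₁ q₂ m (trans (sym eq₁) eq₂)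
... | refl = cong (divides q₁) (≡-irrelevant eq₁ eq₂)

^-∣ : ∀ P {a b} → a ≤ b → P ^ a ∣ P ^ b
^-∣ P {b = b} z≤n = 1∣ (P ^ b)
^-∣ P (s≤s a≤b) = *-monoʳ-∣ P (^-∣ P a≤b)

^-cancelʳ-< : ∀ P {a b} → 1 < P → P ^ a < P ^ b → a < b
^-cancelʳ-< P 1<P lt =
  ≰⇒> (λ b≤a → <⇒≱ lt (^-monoʳ-≤ P {{>-nonZero (<-trans z<s 1<P)}} b≤a))

^-injective : ∀ P {a b} → 1 < P → P ^ a ≡ P ^ b → a ≡ b
^-injective P {a} {b} 1<P eq with <-cmp a b
... | tri< a<b _ _ = contradiction eq (<⇒≢ (^-monoʳ-< P 1<P a<b))
... | tri≈ _ a≡b _ = a≡b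
... | tri> _ _ b<a = contradiction (sym eq) (<⇒≢ (^-monoʳ-< P 1<P b<a))

primeFactor : ∀ {n} → 1 < n → ∃ λ r → Prime r × r ∣ n
primeFactor {n} 1<n with factorise n {{>-nonZero (<-trans z<s 1<n)}}
... | record { factors = [] ; isFactorisation = n≡1 } = contradiction n≡1 (>⇒≢ 1<n)
... | record { factors = r ∷ rs ; isFactorisation = n≡ ; factorsPrime = pr All.∷ _ } =
  r , pr , subst (r ∣_) (sym n≡) (m∣m*n (product rs))

prime∣^⇒≡ : ∀ {r P} k → Prime r → Prime P → r ∣ P ^ k → r ≡ P
prime∣^⇒≡ zero pr _ r∣1 = contradiction (∣1⇒≡1 r∣1) (>⇒≢ (prime⇒1< pr))
prime∣^⇒≡ {P = P} (suc k) pr pP r∣P^k+1 with euclidsLemma P (P ^ k) pr r∣P^k+1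
... | inj₂ r∣P^k = prime∣^⇒≡ k pr pP r∣P^k
... | inj₁ r∣P with prime⇒irreducible pP r∣P
...   | inj₁ r≡1 = contradiction r≡1 (>⇒≢ (prime⇒1< pr))
...   | inj₂ r≡P = r≡P

product≡^length : ∀ {q} xs → (∀ {x} → x ∈ xs → x ≡ q) → product xs ≡ q ^ length xs
product≡^length []       _    = refl
product≡^length (x ∷ xs) x≡q = cong₂ _*_ (x≡q (here refl)) (product≡^length xs (x≡q ∘ there))

primeFactors≡⇒≡^ : ∀ {n q} .{{_ : NonZero n}} →
                   (∀ {r} → Prime r → r ∣ n → r ≡ q) → ∃ λ k → n ≡ q ^ k
primeFactors≡⇒≡^ {n} {q} r≡q =
  length (factors fn) , trans isFactorisation (product≡^length (factors fn) factor≡q)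
  where
  fn = factorise n
  open PrimeFactorisation fn
  factor≡q : ∀ {x} → x ∈ factors fn → x ≡ q
  factor≡q x∈ =
    r≡q (All.lookup factorsPrime x∈) (subst (_ ∣_) (sym isFactorisation) (∈⇒∣product x∈))

∣^⇒≡^ : ∀ {P d} k .{{_ : NonZero d}} → Prime P → d ∣ P ^ k → ∃ λ j → d ≡ P ^ j
∣^⇒≡^ k pP d∣P^k = primeFactors≡⇒≡^ (λ pr r∣d → prime∣^⇒≡ k pr pP (∣-trans r∣d d∣P^k))

properDivisor-≡ : ∀ {n} {u v : ProperDivisor n} → proj₁ u ≡ proj₁ v → u ≡ v
properDivisor-≡ {u = d , 1<d , d<n , d∣n} {v = .d , 1<d′ , d<n′ , d∣n′} refl
  rewrite ≤-irrelevant 1<d 1<d′ | ≤-irrelevant d<n d<n′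
        | ∣-irrelevant {{>-nonZero (<-trans z<s 1<d)}} d∣n d∣n′ = refl

to-preserves-≢ : ∀ {n m} (f : ProperDivisor n ⤖ ProperDivisor m) {u v} →
                 proj₁ u ≢ proj₁ v → proj₁ (to f u) ≢ proj₁ (to f v)
to-preserves-≢ f u≢v fu≡fv = u≢v (cong proj₁ (Bijection.injective f (properDivisor-≡ fu≡fv)))

powerVertex : ∀ {P γ} → 1 < P → ∀ k → suc k < γ → ProperDivisor (P ^ γ)
powerVertex {P} 1<P k k+1<γ =
  P ^ suc k , ^-monoʳ-< P 1<P (z<s {k}) , ^-monoʳ-< P 1<P k+1<γ , ^-∣ P (<⇒≤ k+1<γ)

powerVertices : ∀ {P} γ → Prime P → Fin γ ⤖ ProperDivisor (P ^ suc γ)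
powerVertices {P} γ pP = mk⤖ (injective , strictlySurjective⇒surjective surjective)
  where
  1<P = prime⇒1< pP
  vertex : Fin γ → ProperDivisor (P ^ suc γ)
  vertex i = powerVertex 1<P (toℕ i) (s<s (toℕ<n i))
  injective : ∀ {i j} → vertex i ≡ vertex j → i ≡ j
  injective eq = toℕ-injective (suc-injective (^-injective P 1<P (cong proj₁ eq)))
  surjective : ∀ w → ∃ λ i → vertex i ≡ w
  surjective (d , 1<d , d<P^γ , d∣P^γ)
    with ∣^⇒≡^ (suc γ) {{>-nonZero (<-trans z<s 1<d)}} pP d∣P^γ
  ... | zero  , refl = contradiction 1<d (<-irrefl refl)
  ... | suc k , refl = fromℕ< k<γ , properDivisor-≡ (cong (λ j → P ^ suc j) (toℕ-fromℕ< k<γ))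
    where
    k<γ : k < γ
    k<γ = ≤-pred (^-cancelʳ-< P 1<P d<P^γ)

properDivisors-⤖⇒≡ : ∀ {P Q} a b → Prime P → Prime Q →
                     ProperDivisor (P ^ suc a) ⤖ ProperDivisor (Q ^ suc b) → a ≡ b
properDivisors-⤖⇒≡ a b pP pQ f =
  cantor-schröder-bernstein (Bijection.injective g) (Bijection.injective (⤖-sym g))
  where
  g : Fin a ⤖ Fin b
  g = ⤖-sym (powerVertices b pQ) ⤖-∘ (f ⤖-∘ powerVertices a pP)

record Dominating (n : ℕ) (u : ProperDivisor n) : Set where
  constructor dominating
  field adjacent : ∀ v → proj₁ u ≢ proj₁ v → Adj n u v

cofactor : ∀ {n} → ProperDivisor n → ℕ
cofactor (_ , _ , _ , d∣n) = quotient d∣n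

≅Υ-preserves-Dominating : ∀ {n m} (iso : n ≅Υ m) {u} →
                          Dominating n u → Dominating m (to (proj₁ iso) u)
≅Υ-preserves-Dominating (f , adj) {u} (dominating u~) = dominating fu~
  where
  fu~ : ∀ w → proj₁ (to f u) ≢ proj₁ w → Adj _ (to f u) w
  fu~ w fu≢w with Bijection.strictlySurjective f w
  ... | v , refl = proj₁ (adj u v) (u~ v (fu≢w ∘ cong (proj₁ ∘ to f) ∘ properDivisor-≡))

powerVertex-dominating : ∀ {P} k (pP : Prime P) →
                         Dominating (P ^ suc (suc k)) (powerVertex (prime⇒1< pP) k ≤-refl)
powerVertex-dominating {P} k pP = dominating adjacent
  where
  adjacent : ∀ v → P ^ suc k ≢ proj₁ v →
             Adj (P ^ suc (suc k)) (powerVertex (prime⇒1< pP) k ≤-refl) v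
  adjacent (d , 1<d , _ , d∣P^k+2) P^k+1≢d = P^k+1≢d , P^k+2∣P^k+1*d
    where
    P∣d : P ∣ d
    P∣d with r , pr , r∣d ← primeFactor 1<d =
      subst (_∣ d) (prime∣^⇒≡ (suc (suc k)) pr pP (∣-trans r∣d d∣P^k+2)) r∣d
    P^k+2∣P^k+1*d : P ^ suc (suc k) ∣ P ^ suc k * d
    P^k+2∣P^k+1*d = subst (_∣ P ^ suc k * d) (*-comm (P ^ suc k) P) (*-monoʳ-∣ (P ^ suc k) P∣d)

dominating⇒cofactor∣ : ∀ {m u} → Dominating m u →
                       ∀ (v : ProperDivisor m) → proj₁ u ≢ proj₁ v → cofactor u ∣ proj₁ v
dominating⇒cofactor∣ {u = d , 1<d , _ , divides e refl} dom v d≢v =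
  *-cancelˡ-∣ d {{>-nonZero (<-trans z<s 1<d)}}
    (subst (_∣ d * proj₁ v) (*-comm e d) (proj₂ (Dominating.adjacent dom v d≢v)))

∣∧∣*prime∧<⇒≡ : ∀ {n d p} → Prime p → n ∣ d → d ∣ n * p → d < n * p → d ≡ n
∣∧∣*prime∧<⇒≡ {n} {p = p} pp (divides t refl) tn∣np tn<np
  with prime⇒irreducible pp (*-cancelʳ-∣ {t} {p} n {{n≢0}} (subst (t * n ∣_) (*-comm n p) tn∣np))
  where n≢0 = m*n≢0⇒m≢0 n {{>-nonZero (≤-<-trans z≤n tn<np)}}
... | inj₁ refl = *-identityˡ n
... | inj₂ refl = contradiction (*-comm p n) (<⇒≢ tn<np)

dominatingPrime⇒≡cofactor : ∀ {m u} → Dominating m u → Prime (proj₁ u) →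
                            ∀ (v : ProperDivisor m) → proj₁ u ≢ proj₁ v → proj₁ v ≡ cofactor u
dominatingPrime⇒≡cofactor {u = _ , _ , _ , divides _ refl} dom pd v@(_ , _ , w<m , w∣m) d≢w =
  ∣∧∣*prime∧<⇒≡ pd (dominating⇒cofactor∣ dom v d≢w) w∣m w<m

dominatingPrime⇒others≡ : ∀ {m u} → Dominating m u → Prime (proj₁ u) →
                          ∀ (v w : ProperDivisor m) →
                          proj₁ u ≢ proj₁ v → proj₁ u ≢ proj₁ w → proj₁ v ≡ proj₁ w
dominatingPrime⇒others≡ dom pd v w u≢v u≢w =
  trans (dominatingPrime⇒≡cofactor dom pd v u≢v) (sym (dominatingPrime⇒≡cofactor dom pd w u≢w))

dominating¬prime⇒primePower : ∀ {m u} → Composite m → Dominating m u → ¬ Prime (proj₁ u) →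
                              ∃ λ q → Prime q × ∃ λ β → m ≡ q ^ β
dominating¬prime⇒primePower {m} {u@(_ , _ , d<m , d∣m)} cm dom ¬pd =
  e , pe , primeFactors≡⇒≡^ {{composite⇒nonZero cm}} prime∣m⇒≡e
  where
  e = cofactor u
  1<e : 1 < e
  1<e = quotient>1 d∣m d<m
  prime∣m⇒≡e : ∀ {r} → Prime r → r ∣ m → r ≡ e
  prime∣m⇒≡e {r} pr r∣m
    with prime⇒irreducible pr (dominating⇒cofactor∣ dom (r , prime⇒1< pr , r<m , r∣m) d≢r)
    where
    r<m = ≤∧≢⇒< (∣⇒≤ {{composite⇒nonZero cm}} r∣m)
                (λ r≡m → composite⇒¬prime cm (subst Prime r≡m pr))
    d≢r = λ d≡r → ¬pd (subst Prime (sym d≡r) pr)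
  ... | inj₁ e≡1 = contradiction e≡1 (>⇒≢ 1<e)
  ... | inj₂ e≡r = sym e≡r
  pe : Prime e
  pe with r , pr , r∣e ← primeFactor 1<e =
    subst Prime (prime∣m⇒≡e pr (∣-trans r∣e (quotient-∣ d∣m))) pr

proposition3p2 : (p α m : ℕ) → Prime p → 4 ≤ α → Composite m →
    (p ^ α) ≅Υ m → Σ ℕ (λ q → Prime q × (m ≡ q ^ α))
proposition3p2 p _ m pp (s≤s (s≤s (s≤s (s≤s {n = a} _)))) cm iso@(f , _) =
  byPrimality (prime? (proj₁ (to f top)))
  where
  k = suc (suc a)
  α = suc (suc k)
  1<p = prime⇒1< pp
  low mid top : ProperDivisor (p ^ α)
  low = powerVertex {γ = α} 1<p 0 (s≤s (s≤s z≤n))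
  mid = powerVertex {γ = α} 1<p 1 (s≤s (s≤s (s≤s z≤n)))
  top = powerVertex {γ = α} 1<p k ≤-refl
  dom : Dominating m (to f top)
  dom = ≅Υ-preserves-Dominating iso (powerVertex-dominating k pp)
  distinct : ∀ {i j} → i ≢ j → p ^ i ≢ p ^ j
  distinct i≢j = i≢j ∘ ^-injective p 1<p
  top≢low : proj₁ (to f top) ≢ proj₁ (to f low)
  top≢low = to-preserves-≢ f (distinct {suc k} {1} λ ())
  top≢mid : proj₁ (to f top) ≢ proj₁ (to f mid)
  top≢mid = to-preserves-≢ f (distinct {suc k} {2} λ ())
  low≢mid : proj₁ (to f low) ≢ proj₁ (to f mid)
  low≢mid = to-preserves-≢ f (distinct {1} {2} λ ())
  byPrimality : Dec (Prime (proj₁ (to f top))) → Σ ℕ (λ q → Prime q × (m ≡ q ^ α))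
  byPrimality (yes prime-top) = contradiction
    (dominatingPrime⇒others≡ dom prime-top (to f low) (to f mid) top≢low top≢mid) low≢mid
  byPrimality (no ¬prime-top) with dominating¬prime⇒primePower cm dom ¬prime-top
  ... | q , pq , zero , refl =
    contradiction (nonTrivial⇒n>1 1 {{composite⇒nonTrivial cm}}) (<-irrefl refl)
  ... | q , pq , suc β , refl =
    q , pq , cong (λ b → q ^ suc b) (sym (properDivisors-⤖⇒≡ (suc k) β pp pq f))
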